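{- Let $U$ be a subset of $\mathcal{S}$ and $a$ an ASHE. If $a$ is non-blocking on $U$ (i.e. $B(x)=\emptyset$ for all $x\in U$), then the smallest interval containing $U\cdot a$ equals $[\inf U,\sup U]\boxdot a$.
   Context: $\mathcal{S}=[0,C]\subset\mathbb{Z}^d$ with the componentwise order. $a$ is an almost space homogeneous event (ASHE) with direction vector $v$ and blocking relation $\mathcal{R}$: with $CR(x)=\{i: x_i+v_i\notin[0,C_i]\}$ and $B(x)=\{i:\exists j\in CR(x),(j,i)\in\mathcal{R}\}$, $(x\cdot a)_i=x_i$ if $i\in B(x)$ and $(x\cdot a)_i=\max(0,\min(C_i,x_i+v_i))$ otherwise. For an interval $[m,M]$, $[m,M]\boxdot a=[\inf_{m\le x\le M} x\cdot a,\ \sup_{m\le x\le M} x\cdot a]$, the smallest interval containing $[m,M]\cdot a$. The smallest interval containing a set $W$ is $[\inf W,\sup W]$. -}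

module Defs where

open import Data.Nat using (ℕ)
open import Data.Integer using (ℤ; +_; _+_; _≤_; _≤?_; _⊓_; _⊔_)
open import Data.Fin using (Fin)
open import Data.Fin.Properties using (any?)
open import Data.Product using (Σ; ∃; _×_; _,_)
open import Relation.Nullary using (¬_; Dec; yes; no)
open import Relation.Nullary.Decidable using (_×-dec_; ¬?)
open import Relation.Unary using (Pred)
open import Level using (0ℓ)
open import Relation.Binary.PropositionalEquality using (_≡_)

Pt : ℕ → Set
Pt d = Fin d → ℤ

_≤ᵖ_ : ∀ {d} → Pt d → Pt d → Set
x ≤ᵖ y = ∀ i → x i ≤ y i

InS : ∀ {d} → (Fin d → ℕ) → Pt d → Set
InS C x = ∀ i → (+ 0 ≤ x i) × (x i ≤ + C i)

-- An ASHE: direction vector v and blocking relation R ⊆ [d] × [d]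
-- (a relation on the finite set of coordinates, with its decision procedure).
record ASHE (d : ℕ) : Set₁ where
  field
    v  : Fin d → ℤ
    R  : Fin d → Fin d → Set
    R? : ∀ j i → Dec (R j i)

module _ {d : ℕ} (C : Fin d → ℕ) (a : ASHE d) where
  open ASHE a

  CR : Pt d → Fin d → Set
  CR x i = ¬ ((+ 0 ≤ x i + v i) × (x i + v i ≤ + C i))

  CR? : ∀ x i → Dec (CR x i)
  CR? x i = ¬? ((+ 0 ≤? x i + v i) ×-dec (x i + v i ≤? + C i))

  B : Pt d → Fin d → Set
  B x i = ∃ λ j → CR x j × R j i

  B? : ∀ x i → Dec (B x i)
  B? x i = any? (λ j → CR? x j ×-dec R? j i)

  clamp : Fin d → ℤ → ℤ
  clamp i z = + 0 ⊔ (+ C i ⊓ z)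

  act : Pt d → Pt d
  act x i with B? x i
  ... | yes _ = x i
  ... | no  _ = clamp i (x i + v i)

  NonBlocking : Pred (Pt d) 0ℓ → Set
  NonBlocking U = ∀ x → U x → ∀ i → ¬ B x i

Image : ∀ {d} → (Pt d → Pt d) → Pred (Pt d) 0ℓ → Pred (Pt d) 0ℓ
Image f W y = ∃ λ x → W x × (f x ≡ y)

Interval : ∀ {d} → Pt d → Pt d → Pred (Pt d) 0ℓ
Interval m M x = (m ≤ᵖ x) × (x ≤ᵖ M)

IsInf : ∀ {d} → Pred (Pt d) 0ℓ → Pt d → Set
IsInf W m = (∀ x → W x → m ≤ᵖ x) × (∀ l → (∀ x → W x → l ≤ᵖ x) → l ≤ᵖ m)

IsSup : ∀ {d} → Pred (Pt d) 0ℓ → Pt d → Set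
IsSup W M = (∀ x → W x → x ≤ᵖ M) × (∀ u → (∀ x → W x → x ≤ᵖ u) → M ≤ᵖ u)

-- [m, M] ⊡ a = [inf_{m≤x≤M} x·a , sup_{m≤x≤M} x·a]: its endpoints are the
-- inf/sup of the image of the interval; the smallest interval containing W
-- is [inf W, sup W].

module Submission where

-- On a point x where a is non-blocking, x · a acts coordinatewise:
-- (x · a)_i = step_i (x_i) with step_i z = max(0, min(C_i, z + v_i)), and every
-- step_i is monotone.  A coordinatewise monotone map sends the infimum m of any
-- set W to the infimum of its image (and likewise for suprema): monotonicity
-- gives the lower bound, and if some l were a strictly larger lower bound in
-- coordinate i, every w ∈ W would satisfy w_i > m_i, contradicting that m_i is
-- the greatest lower bound in coordinate i.
--   The theorem applies this twice, with the same candidate endpoints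
-- step(m) and step(M): once to W = U, and once to W = [m, M], whose infimum and
-- supremum are m and M (here m ≤ M because U, having an infimum, is nonempty).
-- The second application needs non-blocking to propagate from U to [m, M]: the coordinates j that can block are confined on U to the safe range
-- [-v_j, C_j - v_j], hence so are m_j, M_j and every coordinate in between.

open import Defs
open import Data.Nat using (ℕ)
open import Data.Fin using (Fin; _≟_)
open import Data.Product using (Σ; _×_; _,_; proj₁; proj₂)
open import Data.Integer using (ℤ; +_; _+_; -_; _-_; _≤_; _≤?_; pred)
  renaming (suc to sucℤ)
open import Data.Integer.Properties
  using (≤-refl; ≤-trans; ≤-reflexive; <-irrefl; ≰⇒>; i<j⇒suc[i]≤j; suc[i]≤j⇒i<j;
         i<j⇒i≤pred[j]; i≤pred[j]⇒i<j; +-monoˡ-≤; ⊔-monoʳ-≤; ⊓-monoʳ-≤;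
         +-0-abelianGroup)
open import Algebra.Properties.AbelianGroup +-0-abelianGroup
  using (//-rightDividesˡ; //-rightDividesʳ)
open import Data.Vec.Functional using (updateAt)
open import Data.Vec.Functional.Properties using (updateAt-updates; updateAt-minimal)
open import Function using (const)
open import Relation.Unary using (Pred)
open import Relation.Nullary using (¬_; yes; no)
open import Relation.Nullary.Decidable using (decidable-stable; _×-dec_)
open import Relation.Binary.PropositionalEquality using (_≡_; refl; sym; subst)
open import Data.Empty using (⊥-elim)
open import Level using (0ℓ)

shift-bounds : ∀ {lo hi t z} → lo ≤ z + t × z + t ≤ hi → lo - t ≤ z × z ≤ hi - t
shift-bounds {lo} {hi} {t} {z} (lo≤ , ≤hi) =
  subst (lo - t ≤_) (//-rightDividesʳ t z) (+-monoˡ-≤ (- t) lo≤) ,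
  subst (_≤ hi - t) (//-rightDividesʳ t z) (+-monoˡ-≤ (- t) ≤hi)

unshift-bounds : ∀ {lo hi t z} → lo - t ≤ z × z ≤ hi - t → lo ≤ z + t × z + t ≤ hi
unshift-bounds {lo} {hi} {t} {z} (lo≤ , ≤hi) =
  subst (_≤ z + t) (//-rightDividesˡ t lo) (+-monoˡ-≤ t lo≤) ,
  subst (z + t ≤_) (//-rightDividesˡ t hi) (+-monoˡ-≤ t ≤hi)

module _ {d : ℕ} {W : Pred (Pt d) 0ℓ} where

  -- The infimum is the greatest lower bound in each coordinate separately:
  -- a bound z on the i-th coordinates of W, written into coordinate i of m,
  -- gives a lower bound of W, which must lie below m.
  inf-coord-glb : ∀ {m} → IsInf W m → ∀ i z → (∀ w → W w → z ≤ w i) → z ≤ m i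
  inf-coord-glb {m} (lower , greatest) i z z≤ =
    subst (_≤ m i) (updateAt-updates i m) (greatest m[i≔z] m[i≔z]-lower i)
    where
    m[i≔z] : Pt d
    m[i≔z] = updateAt m i (const z)

    m[i≔z]-lower : ∀ w → W w → m[i≔z] ≤ᵖ w
    m[i≔z]-lower w Ww k with k ≟ i
    ... | yes refl = subst (_≤ w k) (sym (updateAt-updates k m)) (z≤ w Ww)
    ... | no k≢i   = subst (_≤ w k) (sym (updateAt-minimal k i m k≢i)) (lower w Ww k)

  sup-coord-lub : ∀ {M} → IsSup W M → ∀ i z → (∀ w → W w → w i ≤ z) → M i ≤ z
  sup-coord-lub {M} (upper , least) i z ≤z =
    subst (M i ≤_) (updateAt-updates i M) (least M[i≔z] M[i≔z]-upper i)
    where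
    M[i≔z] : Pt d
    M[i≔z] = updateAt M i (const z)

    M[i≔z]-upper : ∀ w → W w → w ≤ᵖ M[i≔z]
    M[i≔z]-upper w Ww k with k ≟ i
    ... | yes refl = subst (w k ≤_) (sym (updateAt-updates k M)) (≤z w Ww)
    ... | no k≢i   = subst (w k ≤_) (sym (updateAt-minimal k i M k≢i)) (upper w Ww k)

  -- The infimum is not strictly below all of W in any coordinate: otherwise
  -- m_i + 1 would be a larger coordinate lower bound.  (In particular W ≠ ∅.)
  -- These replace attainment of the coordinate infimum, which is classical.
  inf-coord-reached : ∀ {m} → IsInf W m → ∀ i → ¬ (∀ w → W w → ¬ w i ≤ m i)
  inf-coord-reached {m} iW i above =
    <-irrefl refl (suc[i]≤j⇒i<j (inf-coord-glb iW i (sucℤ (m i))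
      (λ w Ww → i<j⇒suc[i]≤j (≰⇒> (above w Ww)))))

  sup-coord-reached : ∀ {M} → IsSup W M → ∀ i → ¬ (∀ w → W w → ¬ M i ≤ w i)
  sup-coord-reached {M} sW i below =
    <-irrefl refl (i≤pred[j]⇒i<j (sup-coord-lub sW i (pred (M i))
      (λ w Ww → i<j⇒i≤pred[j] (≰⇒> (below w Ww)))))

  inf≤sup : ∀ {m M} → IsInf W m → IsSup W M → m ≤ᵖ M
  inf≤sup {m} {M} iW sW i = decidable-stable (m i ≤? M i) λ m≰M →
    inf-coord-reached iW i λ w Ww _ →
      m≰M (≤-trans (proj₁ iW w Ww i) (proj₁ sW w Ww i))

  interval-coord-bounds : ∀ {m M lo hi} → IsInf W m → IsSup W M → ∀ i →
    (∀ w → W w → lo ≤ w i × w i ≤ hi) →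
    ∀ x → Interval m M x → lo ≤ x i × x i ≤ hi
  interval-coord-bounds iW sW i bounded x (m≤x , x≤M) =
    ≤-trans (inf-coord-glb iW i _ (λ w Ww → proj₁ (bounded w Ww))) (m≤x i) ,
    ≤-trans (x≤M i) (sup-coord-lub sW i _ (λ w Ww → proj₂ (bounded w Ww)))

interval-inf : ∀ {d} {m M : Pt d} → m ≤ᵖ M → IsInf (Interval m M) m
interval-inf m≤M = (λ x Ix → proj₁ Ix) , (λ l lower → lower _ ((λ i → ≤-refl) , m≤M))

interval-sup : ∀ {d} {m M : Pt d} → m ≤ᵖ M → IsSup (Interval m M) M
interval-sup m≤M = (λ x Ix → proj₂ Ix) , (λ u upper → upper _ (m≤M , (λ i → ≤-refl)))

apply : ∀ {d} → (Fin d → ℤ → ℤ) → Pt d → Pt d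
apply f x i = f i (x i)

ActsBy : ∀ {d} → (Fin d → ℤ → ℤ) → (Pt d → Pt d) → Pred (Pt d) 0ℓ → Set
ActsBy f F W = ∀ x → W x → ∀ i → F x i ≡ apply f x i

module _ {d : ℕ} (f : Fin d → ℤ → ℤ) (f-mono : ∀ i {y z} → y ≤ z → f i y ≤ f i z) where

  image-inf : ∀ {F W m} → ActsBy f F W → IsInf W m → IsInf (Image F W) (apply f m)
  image-inf {F} {W} {m} acts iW = lower , greatest
    where
    lower : ∀ y → Image F W y → apply f m ≤ᵖ y
    lower _ (x , Wx , refl) i =
      ≤-trans (f-mono i (proj₁ iW x Wx i)) (≤-reflexive (sym (acts x Wx i)))

    -- If l_i ≰ f_i(m_i), no w ∈ W has w_i ≤ m_i, since then l_i ≤ f_i(w_i) ≤ f_i(m_i).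
    greatest : ∀ l → (∀ y → Image F W y → l ≤ᵖ y) → l ≤ᵖ apply f m
    greatest l lower-l i = decidable-stable (l i ≤? apply f m i) λ l≰ →
      inf-coord-reached iW i λ w Ww w≤m →
        l≰ (≤-trans (lower-l (F w) (w , Ww , refl) i)
                    (≤-trans (≤-reflexive (acts w Ww i)) (f-mono i w≤m)))

  image-sup : ∀ {F W M} → ActsBy f F W → IsSup W M → IsSup (Image F W) (apply f M)
  image-sup {F} {W} {M} acts sW = upper , least
    where
    upper : ∀ y → Image F W y → y ≤ᵖ apply f M
    upper _ (x , Wx , refl) i =
      ≤-trans (≤-reflexive (acts x Wx i)) (f-mono i (proj₁ sW x Wx i))

    least : ∀ u → (∀ y → Image F W y → y ≤ᵖ u) → apply f M ≤ᵖ u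
    least u upper-u i = decidable-stable (apply f M i ≤? u i) λ ≰u →
      sup-coord-reached sW i λ w Ww M≤w →
        ≰u (≤-trans (f-mono i M≤w)
                    (≤-trans (≤-reflexive (sym (acts w Ww i))) (upper-u (F w) (w , Ww , refl) i)))

module _ {d : ℕ} (C : Fin d → ℕ) (a : ASHE d) where
  open ASHE a

  step : Fin d → ℤ → ℤ
  step i z = clamp C a i (z + v i)

  step-mono : ∀ i {y z} → y ≤ z → step i y ≤ step i z
  step-mono i y≤z = ⊔-monoʳ-≤ (+ 0) (⊓-monoʳ-≤ (+ C i) (+-monoˡ-≤ (v i) y≤z))

  act-nonBlocking : ∀ {W} → NonBlocking C a W → ActsBy step (act C a) W
  act-nonBlocking nb x Wx i with B? C a x i
  ... | yes blocked = ⊥-elim (nb x Wx i blocked)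
  ... | no _        = refl

  safe-range : ∀ {x j} → ¬ CR C a x j → + 0 - v j ≤ x j × x j ≤ + C j - v j
  safe-range {x} {j} ¬cr =
    shift-bounds (decidable-stable ((+ 0 ≤? x j + v j) ×-dec (x j + v j ≤? + C j)) ¬cr)

  -- Non-blocking on U extends to [inf U, sup U]: any coordinate j that could
  -- block stays in its safe range on U, hence on the whole interval.
  nonBlocking-interval : ∀ {U m M} → NonBlocking C a U → IsInf U m → IsSup U M →
    NonBlocking C a (Interval m M)
  nonBlocking-interval {U} nb iU sU x Ix i (j , crossed , Rji) =
    crossed (unshift-bounds (interval-coord-bounds iU sU j safe x Ix))
    where
    safe : ∀ u → U u → + 0 - v j ≤ u j × u j ≤ + C j - v j
    safe u Uu = safe-range {u} λ cr → nb u Uu i (j , cr , Rji)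

proposition4 : (d : ℕ) (C : Fin d → ℕ) (a : ASHE d) (U : Pred (Pt d) 0ℓ)
    → (∀ x → U x → InS C x)
    → NonBlocking C a U
    → (m M : Pt d) → IsInf U m → IsSup U M
    → Σ (Pt d) (λ p → IsInf (Image (act C a) U) p × IsInf (Image (act C a) (Interval m M)) p)
      × Σ (Pt d) (λ q → IsSup (Image (act C a) U) q × IsSup (Image (act C a) (Interval m M)) q)
proposition4 d C a U _ nbU m M iU sU =
  (apply f m , image-inf f f-mono actsU iU , image-inf f f-mono actsI (interval-inf m≤M)) ,
  (apply f M , image-sup f f-mono actsU sU , image-sup f f-mono actsI (interval-sup m≤M))
  where
  f : Fin d → ℤ → ℤ
  f = step C a

  f-mono : ∀ i {y z} → y ≤ z → f i y ≤ f i z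
  f-mono = step-mono C a

  m≤M : m ≤ᵖ M
  m≤M = inf≤sup iU sU

  actsU : ActsBy f (act C a) U
  actsU = act-nonBlocking C a nbU

  actsI : ActsBy f (act C a) (Interval m M)
  actsI = act-nonBlocking C a (nonBlocking-interval C a nbU iU sU)
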